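{- For every integer $n\ge 4$ and every integer $k$ with $2\le k\le n$, the graph $\operatorname{FS}(\mathcal{SW}_n,\mathcal B_{n-k}^{(k)})$ is connected.
   Context: The stopwatch graph $\mathcal{SW}_n$ is the graph on $n$ vertices consisting of a cycle $\mathcal C_{n-1}$ of length $n-1$ together with one additional vertex joined by a single edge to one vertex of the cycle. For simple graphs $\mathcal G,\mathcal F$ on $n$ vertices, $\operatorname{FS}(\mathcal G,\mathcal F)$ has as vertices the bijections $\sigma:\mathtt V(\mathcal G)\to\mathtt V(\mathcal F)$. Two such bijections $\sigma,\sigma'$ are adjacent iff there is an edge $\{A,B\}$ of $\mathcal G$ such that $\{\sigma(A),\sigma(B)\}\in E(\mathcal F)$, $\sigma'(A)=\sigma(B)$, $\sigma'(B)=\sigma(A)$, and $\sigma'=\sigma$ elsewhere. For $1\le k\le n$, $\mathcal B_{n-k}^{(k)}$ is the graph on $n$ vertices with $k$ vertices adjacent to all other vertices and the remaining $n-k$ vertices pairwise non-adjacent. -}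

module Defs where

open import Data.Nat using (ℕ; zero; suc; _∸_; _<_)
open import Data.Fin using (Fin; toℕ)
open import Data.Fin.Permutation using (Permutation; _⟨$⟩ʳ_; _≈_)
open import Data.Product using (Σ; _×_; ∃; ∃-syntax)
open import Data.Sum using (_⊎_)
open import Relation.Binary.PropositionalEquality using (_≡_)
open import Relation.Nullary using (¬_)
open import Relation.Binary.Construct.Closure.ReflexiveTransitive using (Star)

Graph : ℕ → Set₁
Graph n = Fin n → Fin n → Set

-- Directed "half-edges" of the stopwatch graph SW_n:
-- vertices 0,…,n-2 form the cycle C_{n-1} (i ~ i+1, and 0 ~ n-2),
-- vertex n-1 is the pendant vertex, joined to vertex 0.
SWHalf : (n : ℕ) → Fin n → Fin n → Set
SWHalf n i j =
    (toℕ i < n ∸ 1 × toℕ j < n ∸ 1 × suc (toℕ i) ≡ toℕ j)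
  ⊎ (toℕ i ≡ 0 × suc (toℕ j) ≡ n ∸ 1)
  ⊎ (toℕ i ≡ 0 × toℕ j ≡ n ∸ 1)

SW : (n : ℕ) → Graph n
SW n i j = SWHalf n i j ⊎ SWHalf n j i

B : (n k : ℕ) → Graph n
B n k i j = ¬ (i ≡ j) × (toℕ i < k ⊎ toℕ j < k)

FSAdj : {n : ℕ} → Graph n → Graph n → Permutation n n → Permutation n n → Set
FSAdj {n} G F σ σ′ =
  Σ (Fin n) λ a → Σ (Fin n) λ b →
    G a b × F (σ ⟨$⟩ʳ a) (σ ⟨$⟩ʳ b)
    × σ′ ⟨$⟩ʳ a ≡ σ ⟨$⟩ʳ b
    × σ′ ⟨$⟩ʳ b ≡ σ ⟨$⟩ʳ a
    × (∀ x → ¬ (x ≡ a) → ¬ (x ≡ b) → σ′ ⟨$⟩ʳ x ≡ σ ⟨$⟩ʳ x)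

-- FS(G, F) is connected: any two bijections are joined by a walk
-- (bijections identified when they agree as functions).
FSConnected : {n : ℕ} → Graph n → Graph n → Set
FSConnected {n} G F =
  ∀ (σ τ : Permutation n n) →
    ∃[ ρ ] (Star (FSAdj G F) σ ρ × ρ ≈ τ)

{-# OPTIONS --safe #-}
-- Number the vertices of SW_n along its Hamiltonian path: pendant 0, hub 1, then the cycle
-- 1, 2, …, n-1 closed by the chord {1, n-1}. A universal label (one of 0, …, k-1) may trade
-- places with any neighbour, so it can walk along a path pushing the labels it passes one
-- step back. Walking the labels 0, …, k-1 down to positions 0, …, k-1 brings every
-- configuration to a normal form, and two normal forms differ by a permutation of the
-- strangers, so it remains to swap two strangers s, t. With universal labels on the pendant
-- and on the hub, three exchanges through the hub swap the labels on its other two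
-- neighbours 2 and n-1; letting the hub's label travel round the cycle rotates it, which
-- brings s and t to those neighbours. Finally, exchanging two strangers is an automorphism
-- of B, so the swap found at that configuration transports back to the original one.
module Submission where

open import Defs
open import Data.Nat using (ℕ; zero; suc; _≤_; _<_; _∸_; _+_; z≤n; s≤s)
import Data.Nat.Properties as ℕ
open import Data.Fin using (Fin; zero; suc; toℕ; fromℕ; fromℕ<; punchIn; _≟_)
open import Data.Fin.Patterns using (0F; 1F; 2F; 3F)
open import Data.Fin.Properties using (toℕ-injective; toℕ-fromℕ; toℕ-fromℕ<; toℕ<n; ≤fromℕ; <⇒≢)
open import Data.Fin.Permutation
  using (Permutation′; _⟨$⟩ʳ_; _⟨$⟩ˡ_; _≈_; transpose; _∘ₚ_; flip; insert; insert-punchIn; id;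
         inverseˡ; inverseʳ)
import Data.Fin.Permutation.Components as PC
open import Data.Product using (_×_; _,_; ∃-syntax; map₂)
open import Data.Sum using (_⊎_; inj₁; inj₂)
import Data.Sum as Sum
open import Data.Empty using (⊥)
open import Function.Base using (_∘_)
open import Function.Bundles using (Injection)
open import Function.Properties.Inverse using (↔⇒↣)
open import Relation.Binary.PropositionalEquality
  using (_≡_; _≢_; refl; sym; trans; cong; cong₂; subst; subst₂; ≢-sym; module ≡-Reasoning)
open import Relation.Nullary using (¬_; Dec; yes; no; contradiction)
open import Relation.Nullary.Decidable using (dec-true; dec-false)
open import Relation.Binary.Construct.Closure.ReflexiveTransitive
  using (Star; ε; _◅_; _◅◅_; gmap; reverse)

private
  variable
    n : ℕ

⟨$⟩ʳ-injective : ∀ (σ : Permutation′ n) {x y} → σ ⟨$⟩ʳ x ≡ σ ⟨$⟩ʳ y → x ≡ y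
⟨$⟩ʳ-injective σ = Injection.injective (↔⇒↣ σ)

transpose-matchˡ : ∀ (i j : Fin n) → PC.transpose i j i ≡ j
transpose-matchˡ i j rewrite dec-true (i ≟ i) refl = refl

transpose-matchʳ : ∀ (i j : Fin n) → PC.transpose i j j ≡ i
transpose-matchʳ i j with j ≟ i
... | yes j≡i = j≡i
... | no  j≢i rewrite dec-true (j ≟ j) refl = refl

transpose-fixed : ∀ {i j k : Fin n} → k ≢ i → k ≢ j → PC.transpose i j k ≡ k
transpose-fixed {i = i} {j} {k} k≢i k≢j rewrite dec-false (k ≟ i) k≢i | dec-false (k ≟ j) k≢j = refl

transpose-natural : ∀ (ρ : Permutation′ n) x y z →
  ρ ⟨$⟩ʳ PC.transpose x y z ≡ PC.transpose (ρ ⟨$⟩ʳ x) (ρ ⟨$⟩ʳ y) (ρ ⟨$⟩ʳ z)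
transpose-natural ρ x y z = cases (z ≟ x) (z ≟ y)
  where
  cases : Dec (z ≡ x) → Dec (z ≡ y) →
          ρ ⟨$⟩ʳ PC.transpose x y z ≡ PC.transpose (ρ ⟨$⟩ʳ x) (ρ ⟨$⟩ʳ y) (ρ ⟨$⟩ʳ z)
  cases (yes refl) _ =
    trans (cong (ρ ⟨$⟩ʳ_) (transpose-matchˡ z y)) (sym (transpose-matchˡ (ρ ⟨$⟩ʳ z) (ρ ⟨$⟩ʳ y)))
  cases (no _) (yes refl) =
    trans (cong (ρ ⟨$⟩ʳ_) (transpose-matchʳ x z)) (sym (transpose-matchʳ (ρ ⟨$⟩ʳ x) (ρ ⟨$⟩ʳ z)))
  cases (no z≢x) (no z≢y) =
    trans (cong (ρ ⟨$⟩ʳ_) (transpose-fixed z≢x z≢y))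
          (sym (transpose-fixed (z≢x ∘ ⟨$⟩ʳ-injective ρ) (z≢y ∘ ⟨$⟩ʳ-injective ρ)))

transpose-involutive : ∀ (i j k : Fin n) → PC.transpose i j (PC.transpose i j k) ≡ k
transpose-involutive i j k = cases (k ≟ i) (k ≟ j)
  where
  cases : Dec (k ≡ i) → Dec (k ≡ j) → PC.transpose i j (PC.transpose i j k) ≡ k
  cases (yes refl) _ = trans (cong (PC.transpose k j) (transpose-matchˡ k j)) (transpose-matchʳ k j)
  cases (no _) (yes refl) = trans (cong (PC.transpose i k) (transpose-matchʳ i k)) (transpose-matchˡ i k)
  cases (no k≢i) (no k≢j) =
    trans (cong (PC.transpose i j) (transpose-fixed k≢i k≢j)) (transpose-fixed k≢i k≢j)

transpose-comm : ∀ (i j k : Fin n) → PC.transpose i j k ≡ PC.transpose j i k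
transpose-comm i j k = cases (k ≟ i) (k ≟ j)
  where
  cases : Dec (k ≡ i) → Dec (k ≡ j) → PC.transpose i j k ≡ PC.transpose j i k
  cases (yes refl) _ = trans (transpose-matchˡ k j) (sym (transpose-matchʳ j k))
  cases (no _) (yes refl) = trans (transpose-matchʳ i k) (sym (transpose-matchˡ k i))
  cases (no k≢i) (no k≢j) = trans (transpose-fixed k≢i k≢j) (sym (transpose-fixed k≢j k≢i))

transpose-conjugate : ∀ {a b c : Fin n} → c ≢ a → c ≢ b → a ≢ b → ∀ x →
  PC.transpose c a (PC.transpose c b (PC.transpose c a x)) ≡ PC.transpose a b x
transpose-conjugate {a = a} {b} {c} c≢a c≢b a≢b x = begin
  PC.transpose c a (PC.transpose c b (PC.transpose c a x))
    ≡⟨ transpose-natural (transpose c a) c b (PC.transpose c a x) ⟩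
  PC.transpose (PC.transpose c a c) (PC.transpose c a b) (PC.transpose c a (PC.transpose c a x))
    ≡⟨ cong₂ (λ u v → PC.transpose u v (PC.transpose c a (PC.transpose c a x)))
         (transpose-matchˡ c a) (transpose-fixed (≢-sym c≢b) (≢-sym a≢b)) ⟩
  PC.transpose a b (PC.transpose c a (PC.transpose c a x))
    ≡⟨ cong (PC.transpose a b) (transpose-involutive c a x) ⟩
  PC.transpose a b x ∎
  where open ≡-Reasoning

transpose-triangle : ∀ {a b p : Fin n} → p ≢ a → p ≢ b → a ≢ b → ∀ x →
  PC.transpose a p (PC.transpose a b (PC.transpose p b x)) ≡ PC.transpose a b x
transpose-triangle {a = a} {b} {p} p≢a p≢b a≢b x = begin
  PC.transpose a p (PC.transpose a b (PC.transpose p b x))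
    ≡⟨ transpose-natural (transpose a p) a b (PC.transpose p b x) ⟩
  PC.transpose (PC.transpose a p a) (PC.transpose a p b) (PC.transpose a p (PC.transpose p b x))
    ≡⟨ cong₂ (λ u v → PC.transpose u v (PC.transpose a p (PC.transpose p b x)))
         (transpose-matchˡ a p) (transpose-fixed (≢-sym a≢b) (≢-sym p≢b)) ⟩
  PC.transpose p b (PC.transpose a p (PC.transpose p b x))
    ≡⟨ cong (PC.transpose p b) (transpose-comm a p (PC.transpose p b x)) ⟩
  PC.transpose p b (PC.transpose p a (PC.transpose p b x))
    ≡⟨ transpose-conjugate p≢b p≢a (≢-sym a≢b) x ⟩
  PC.transpose b a x
    ≡⟨ transpose-comm b a x ⟩
  PC.transpose a b x ∎
  where open ≡-Reasoning

transpose∘ₚ-matchˡ : ∀ (σ : Permutation′ n) i j → (transpose i j ∘ₚ σ) ⟨$⟩ʳ i ≡ σ ⟨$⟩ʳ j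
transpose∘ₚ-matchˡ σ i j = cong (σ ⟨$⟩ʳ_) (transpose-matchˡ i j)

transpose∘ₚ-matchʳ : ∀ (σ : Permutation′ n) i j → (transpose i j ∘ₚ σ) ⟨$⟩ʳ j ≡ σ ⟨$⟩ʳ i
transpose∘ₚ-matchʳ σ i j = cong (σ ⟨$⟩ʳ_) (transpose-matchʳ i j)

transpose∘ₚ-fixed : ∀ (σ : Permutation′ n) {i j k} → k ≢ i → k ≢ j →
                    (transpose i j ∘ₚ σ) ⟨$⟩ʳ k ≡ σ ⟨$⟩ʳ k
transpose∘ₚ-fixed σ k≢i k≢j = cong (σ ⟨$⟩ʳ_) (transpose-fixed k≢i k≢j)

m+0≡n⇒m≡n : ∀ {m o} → m + 0 ≡ o → m ≡ o
m+0≡n⇒m≡n {m} e = trans (sym (ℕ.+-identityʳ m)) e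

m+1+d≡n⇒1+m+d≡n : ∀ {m d o} → m + suc d ≡ o → suc m + d ≡ o
m+1+d≡n⇒1+m+d≡n {m} {d} e = trans (sym (ℕ.+-suc m d)) e

m+1+d≡n⇒m<n : ∀ {m d o} → m + suc d ≡ o → m < o
m+1+d≡n⇒m<n {m} {d} e = subst (suc m ≤_) (m+1+d≡n⇒1+m+d≡n e) (ℕ.m≤m+n (suc m) d)

AgreeBelow : ℕ → Permutation′ n → Permutation′ n → Set
AgreeBelow j σ τ = ∀ x → toℕ x < j → σ ⟨$⟩ʳ x ≡ τ ⟨$⟩ʳ x

AgreeBelow-extend : ∀ {j} {σ τ : Permutation′ n} x → toℕ x ≡ j → σ ⟨$⟩ʳ x ≡ τ ⟨$⟩ʳ x →
                    AgreeBelow j σ τ → AgreeBelow (suc j) σ τ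
AgreeBelow-extend {j = j} x x≡j σx≡τx agree z z<1+j with toℕ z ℕ.≟ j
... | yes z≡j with toℕ-injective {i = z} {x} (trans z≡j (sym x≡j))
...   | refl = σx≡τx
AgreeBelow-extend x x≡j σx≡τx agree z z<1+j | no z≢j = agree z (ℕ.≤∧≢⇒< (ℕ.≤-pred z<1+j) z≢j)

module Sorting (Universal : Fin n → Set) where

  AgreeOnUniversal : Permutation′ n → Permutation′ n → Set
  AgreeOnUniversal σ τ = ∀ x → Universal (σ ⟨$⟩ʳ x) → σ ⟨$⟩ʳ x ≡ τ ⟨$⟩ʳ x

  swap-first-disagreement : ∀ {j} σ τ x → toℕ x ≡ j → σ ⟨$⟩ʳ x ≢ τ ⟨$⟩ʳ x →
    AgreeOnUniversal σ τ → AgreeBelow j σ τ →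
    ¬ Universal (σ ⟨$⟩ʳ x) × ¬ Universal (τ ⟨$⟩ʳ x) ×
    AgreeOnUniversal (σ ∘ₚ transpose (σ ⟨$⟩ʳ x) (τ ⟨$⟩ʳ x)) τ ×
    AgreeBelow (suc j) (σ ∘ₚ transpose (σ ⟨$⟩ʳ x) (τ ⟨$⟩ʳ x)) τ
  swap-first-disagreement {j} σ τ x x≡j σx≢τx agree below = ¬uσx , ¬uτx , agree′ , below′
    where
    ¬uσx : ¬ Universal (σ ⟨$⟩ʳ x)
    ¬uσx u = σx≢τx (agree x u)
    ¬uτx : ¬ Universal (τ ⟨$⟩ʳ x)
    ¬uτx u = σx≢τx (trans (cong (σ ⟨$⟩ʳ_) x≡y) (inverseʳ σ))
      where
      y : Fin n
      y = σ ⟨$⟩ˡ (τ ⟨$⟩ʳ x)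
      x≡y : x ≡ y
      x≡y = ⟨$⟩ʳ-injective τ (trans (sym (inverseʳ σ)) (agree y (subst Universal (sym (inverseʳ σ)) u)))
    σ′ : Permutation′ n
    σ′ = σ ∘ₚ transpose (σ ⟨$⟩ʳ x) (τ ⟨$⟩ʳ x)
    σ′x≡τx : σ′ ⟨$⟩ʳ x ≡ τ ⟨$⟩ʳ x
    σ′x≡τx = transpose-matchˡ (σ ⟨$⟩ʳ x) (τ ⟨$⟩ʳ x)
    agree′ : AgreeOnUniversal σ′ τ
    agree′ y u = cases (σ ⟨$⟩ʳ y ≟ σ ⟨$⟩ʳ x) (σ ⟨$⟩ʳ y ≟ τ ⟨$⟩ʳ x)
      where
      cases : Dec (σ ⟨$⟩ʳ y ≡ σ ⟨$⟩ʳ x) → Dec (σ ⟨$⟩ʳ y ≡ τ ⟨$⟩ʳ x) →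
              σ′ ⟨$⟩ʳ y ≡ τ ⟨$⟩ʳ y
      cases (yes σy≡σx) _ with ⟨$⟩ʳ-injective σ σy≡σx
      ... | refl = σ′x≡τx
      cases (no _) (yes σy≡τx) =
        contradiction (subst Universal (trans (cong (PC.transpose (σ ⟨$⟩ʳ x) (τ ⟨$⟩ʳ x)) σy≡τx)
                                              (transpose-matchʳ (σ ⟨$⟩ʳ x) (τ ⟨$⟩ʳ x))) u) ¬uσx
      cases (no σy≢σx) (no σy≢τx) = trans σ′y≡σy (agree y (subst Universal σ′y≡σy u))
        where
        σ′y≡σy : σ′ ⟨$⟩ʳ y ≡ σ ⟨$⟩ʳ y
        σ′y≡σy = transpose-fixed σy≢σx σy≢τx
    below′ : AgreeBelow (suc j) σ′ τ
    below′ = AgreeBelow-extend {σ = σ′} {τ} x x≡j σ′x≡τx λ z z<j →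
      let z≢x = λ z≡x → ℕ.<-irrefl (trans (cong toℕ z≡x) x≡j) z<j in
      trans (transpose-fixed (z≢x ∘ ⟨$⟩ʳ-injective σ)
                             (z≢x ∘ ⟨$⟩ʳ-injective τ ∘ trans (sym (below z z<j))))
            (below z z<j)

  module _ {_~_ : Permutation′ n → Permutation′ n → Set}
           (≈⇒~ : ∀ {σ τ} → σ ≈ τ → σ ~ τ)
           (~-trans : ∀ {σ ρ τ} → σ ~ ρ → ρ ~ τ → σ ~ τ)
           (swap : ∀ σ {s t} → ¬ Universal s → ¬ Universal t → s ≢ t → σ ~ (σ ∘ₚ transpose s t))
           where

    sort : ∀ σ τ → AgreeOnUniversal σ τ → σ ~ τ
    sort σ τ agree = go n 0 σ (ℕ.+-identityʳ n) agree (λ _ ())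
      where
      go : ∀ d j σ → d + j ≡ n → AgreeOnUniversal σ τ → AgreeBelow j σ τ → σ ~ τ
      go zero j σ d+j≡n _ below = ≈⇒~ (λ x → below x (subst (toℕ x <_) (sym d+j≡n) (toℕ<n x)))
      go (suc d) j σ 1+d+j≡n agree below = repair x (toℕ-fromℕ< j<n) (σ ⟨$⟩ʳ x ≟ τ ⟨$⟩ʳ x)
        where
        j<n : j < n
        j<n = subst (j <_) 1+d+j≡n (s≤s (ℕ.m≤n+m j d))
        x : Fin n
        x = fromℕ< j<n
        d+1+j≡n : d + suc j ≡ n
        d+1+j≡n = trans (ℕ.+-suc d j) 1+d+j≡n
        repair : ∀ x → toℕ x ≡ j → Dec (σ ⟨$⟩ʳ x ≡ τ ⟨$⟩ʳ x) → σ ~ τ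
        repair x x≡j (yes σx≡τx) =
          go d (suc j) σ d+1+j≡n agree (AgreeBelow-extend {σ = σ} {τ} x x≡j σx≡τx below)
        repair x x≡j (no σx≢τx) with swap-first-disagreement σ τ x x≡j σx≢τx agree below
        ... | ¬uσx , ¬uτx , agree′ , below′ =
          ~-trans (swap σ ¬uσx ¬uτx σx≢τx) (go d (suc j) _ d+1+j≡n agree′ below′)

module FS {n : ℕ} (G F : Graph n) where

  data Step (σ τ : Permutation′ n) : Set where
    move : FSAdj G F σ τ → Step σ τ
    same : σ ≈ τ → Step σ τ

  infix 4 _⇝_
  _⇝_ : Permutation′ n → Permutation′ n → Set
  _⇝_ = Star Step

  Reachable : Permutation′ n → (Permutation′ n → Set) → Set
  Reachable σ P = ∃[ ρ ] (σ ⇝ ρ × P ρ)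

  ⇝-Reachable : ∀ {σ σ′ P} → σ ⇝ σ′ → Reachable σ′ P → Reachable σ P
  ⇝-Reachable σ⇝σ′ (ρ , σ′⇝ρ , p) = ρ , σ⇝σ′ ◅◅ σ′⇝ρ , p

  Reachable-map : ∀ {σ P Q} → (∀ ρ → P ρ → Q ρ) → Reachable σ P → Reachable σ Q
  Reachable-map f (ρ , σ⇝ρ , p) = ρ , σ⇝ρ , f ρ p

  Reachable-bind : ∀ {σ P Q} → Reachable σ P → (∀ ρ → P ρ → Reachable ρ Q) → Reachable σ Q
  Reachable-bind (ρ , σ⇝ρ , p) k = ⇝-Reachable σ⇝ρ (k ρ p)

  ≈⇒⇝ : ∀ {σ τ} → σ ≈ τ → σ ⇝ τ
  ≈⇒⇝ σ≈τ = same σ≈τ ◅ ε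

  FSAdj-respˡ : ∀ {σ σ′ τ} → σ ≈ σ′ → FSAdj G F σ′ τ → FSAdj G F σ τ
  FSAdj-respˡ σ≈σ′ (a , b , g , f , τa , τb , τ-elsewhere) =
    a , b , g , subst₂ F (sym (σ≈σ′ a)) (sym (σ≈σ′ b)) f ,
    trans τa (sym (σ≈σ′ b)) , trans τb (sym (σ≈σ′ a)) ,
    λ x x≢a x≢b → trans (τ-elsewhere x x≢a x≢b) (sym (σ≈σ′ x))

  ⇝⇒FSConnected : (∀ σ τ → σ ⇝ τ) → FSConnected G F
  ⇝⇒FSConnected connected σ τ = walk (connected σ τ)
    where
    walk : ∀ {σ τ} → σ ⇝ τ → ∃[ ρ ] (Star (FSAdj G F) σ ρ × ρ ≈ τ)
    walk {σ} ε = σ , ε , λ _ → refl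
    walk (move adj ◅ steps) with walk steps
    ... | ρ , adjs , ρ≈τ = ρ , adj ◅ adjs , ρ≈τ
    walk {σ} (_◅_ {j = σ′} (same σ≈σ′) steps) with walk steps
    ... | ρ , ε , ρ≈τ = σ , ε , λ x → trans (σ≈σ′ x) (ρ≈τ x)
    ... | ρ , _◅_ {j = ρ′} adj adjs , ρ≈τ =
      ρ , _◅_ {j = ρ′} (FSAdj-respˡ {σ} {σ′} {ρ′} σ≈σ′ adj) adjs , ρ≈τ

  swap-⇝ : ∀ σ {a b} → G a b → F (σ ⟨$⟩ʳ a) (σ ⟨$⟩ʳ b) → σ ⇝ transpose a b ∘ₚ σ
  swap-⇝ σ {a} {b} g f =
    move (a , b , g , f , transpose∘ₚ-matchˡ σ a b , transpose∘ₚ-matchʳ σ a b ,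
          λ x x≢a x≢b → transpose∘ₚ-fixed σ x≢a x≢b) ◅ ε

  module _ (F-sym : ∀ {i j} → F i j → F j i) where

    Step-sym : ∀ {σ τ} → Step σ τ → Step τ σ
    Step-sym (move (a , b , g , f , τa , τb , τ-elsewhere)) =
      move (a , b , g , subst₂ F (sym τa) (sym τb) (F-sym f) , sym τb , sym τa ,
            λ x x≢a x≢b → sym (τ-elsewhere x x≢a x≢b))
    Step-sym (same σ≈τ) = same (λ x → sym (σ≈τ x))

    ⇝-sym : ∀ {σ τ} → σ ⇝ τ → τ ⇝ σ
    ⇝-sym = reverse (λ {σ} {τ} → Step-sym {σ} {τ})

    module _ (π : Permutation′ n) (π-hom : ∀ {i j} → F i j → F (π ⟨$⟩ʳ i) (π ⟨$⟩ʳ j)) where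

      Step-∘ₚ : ∀ {σ τ} → Step σ τ → Step (σ ∘ₚ π) (τ ∘ₚ π)
      Step-∘ₚ (move (a , b , g , f , τa , τb , τ-elsewhere)) =
        move (a , b , g , π-hom f , cong (π ⟨$⟩ʳ_) τa , cong (π ⟨$⟩ʳ_) τb ,
              λ x x≢a x≢b → cong (π ⟨$⟩ʳ_) (τ-elsewhere x x≢a x≢b))
      Step-∘ₚ (same σ≈τ) = same (λ x → cong (π ⟨$⟩ʳ_) (σ≈τ x))

      -- Relabelling by the automorphism π maps walks to walks.
      ⇝-∘ₚ-transport : ∀ {σ ρ} → σ ⇝ ρ → ρ ⇝ ρ ∘ₚ π → σ ⇝ σ ∘ₚ π
      ⇝-∘ₚ-transport σ⇝ρ ρ⇝ρπ =
        σ⇝ρ ◅◅ ρ⇝ρπ ◅◅ gmap (_∘ₚ π) (λ {σ} {τ} → Step-∘ₚ {σ} {τ}) (⇝-sym σ⇝ρ)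

module _ {G′ G F : Graph n} (φ : Permutation′ n)
         (φ-hom : ∀ {a b} → G′ a b → G (φ ⟨$⟩ʳ a) (φ ⟨$⟩ʳ b)) where

  private
    module FS′ = FS G′ F

  Step-relabel : ∀ {σ τ} → FS′.Step σ τ → FS.Step G F (flip φ ∘ₚ σ) (flip φ ∘ₚ τ)
  Step-relabel {σ} {τ} (FS.move (a , b , g , f , τa , τb , τ-elsewhere)) =
    FS.move (φ ⟨$⟩ʳ a , φ ⟨$⟩ʳ b , φ-hom g ,
             subst₂ F (sym (back σ a)) (sym (back σ b)) f ,
             trans (back τ a) (trans τa (sym (back σ b))) ,
             trans (back τ b) (trans τb (sym (back σ a))) ,
             λ y y≢φa y≢φb → τ-elsewhere (φ ⟨$⟩ˡ y) (away y≢φa) (away y≢φb))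
    where
    back : ∀ ρ x → (flip φ ∘ₚ ρ) ⟨$⟩ʳ (φ ⟨$⟩ʳ x) ≡ ρ ⟨$⟩ʳ x
    back ρ x = cong (ρ ⟨$⟩ʳ_) (inverseˡ φ)
    away : ∀ {y x} → y ≢ φ ⟨$⟩ʳ x → φ ⟨$⟩ˡ y ≢ x
    away y≢φx e = y≢φx (trans (sym (inverseʳ φ)) (cong (φ ⟨$⟩ʳ_) e))
  Step-relabel (FS.same σ≈τ) = FS.same (λ y → σ≈τ (φ ⟨$⟩ˡ y))

  ⇝-connected-relabel : (∀ σ τ → FS′._⇝_ σ τ) → ∀ σ τ → FS._⇝_ G F σ τ
  ⇝-connected-relabel connected σ τ =
    FS.≈⇒⇝ G F (λ x → cong (σ ⟨$⟩ʳ_) (sym (inverseʳ φ)))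
    ◅◅ gmap (flip φ ∘ₚ_) (λ {σ} {τ} → Step-relabel {σ} {τ}) (connected (φ ∘ₚ σ) (φ ∘ₚ τ))
    ◅◅ FS.≈⇒⇝ G F (λ x → cong (τ ⟨$⟩ʳ_) (inverseʳ φ))

infix 4 _⋖_
_⋖_ : Fin n → Fin n → Set
x ⋖ y = suc (toℕ x) ≡ toℕ y

successor : ∀ {x y : Fin n} → toℕ x < toℕ y → ∃[ x′ ] x ⋖ x′
successor {n} {x} {y} x<y = fromℕ< bound , sym (toℕ-fromℕ< bound)
  where
  bound : suc (toℕ x) < n
  bound = ℕ.≤-<-trans x<y (toℕ<n y)

SWLink : (n : ℕ) → Fin n → Fin n → Set
SWLink n a b = a ⋖ b ⊎ (toℕ a ≡ 1 × suc (toℕ b) ≡ n)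

SW′ : (n : ℕ) → Graph n
SW′ n a b = SWLink n a b ⊎ SWLink n b a

pendantFirst : ∀ {m} → Permutation′ (suc m)
pendantFirst {m} = insert 0F (fromℕ m) id

toℕ-punchIn-fromℕ : ∀ {m} (x : Fin m) → toℕ (punchIn (fromℕ m) x) ≡ toℕ x
toℕ-punchIn-fromℕ {suc m} zero = refl
toℕ-punchIn-fromℕ {suc m} (suc x) = cong suc (toℕ-punchIn-fromℕ x)

toℕ-pendantFirst-suc : ∀ {m} (x : Fin m) → toℕ (pendantFirst ⟨$⟩ʳ suc x) ≡ toℕ x
toℕ-pendantFirst-suc {m} x =
  trans (cong toℕ (insert-punchIn 0F (fromℕ m) id x)) (toℕ-punchIn-fromℕ x)

SWLink-pendantFirst : ∀ {m} {a b : Fin (suc m)} → SWLink (suc m) a b →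
                      SW (suc m) (pendantFirst ⟨$⟩ʳ a) (pendantFirst ⟨$⟩ʳ b)
SWLink-pendantFirst {m} {zero} {suc b} (inj₁ 0⋖b) =
  inj₂ (inj₂ (inj₂ (trans (toℕ-pendantFirst-suc b) (ℕ.suc-injective (sym 0⋖b)) , toℕ-fromℕ m)))
SWLink-pendantFirst {m} {suc a} {suc b} (inj₁ a⋖b)
  rewrite toℕ-pendantFirst-suc a | toℕ-pendantFirst-suc b =
  inj₁ (inj₁ (ℕ.<-trans (ℕ.≤-reflexive (ℕ.suc-injective a⋖b)) (toℕ<n b) ,
              toℕ<n b , ℕ.suc-injective a⋖b))
SWLink-pendantFirst {m} {suc a} {zero} (inj₂ (_ , 1≡1+m)) =
  contradiction (ℕ.suc-injective 1≡1+m) (ℕ.<⇒≢ (ℕ.≤-<-trans z≤n (toℕ<n a)))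
SWLink-pendantFirst {m} {suc a} {suc b} (inj₂ (a≡1 , 1+b≡1+m))
  rewrite toℕ-pendantFirst-suc a | toℕ-pendantFirst-suc b =
  inj₁ (inj₂ (inj₁ (ℕ.suc-injective a≡1 , ℕ.suc-injective 1+b≡1+m)))

SW′-pendantFirst : ∀ {m} {a b : Fin (suc m)} → SW′ (suc m) a b →
                   SW (suc m) (pendantFirst ⟨$⟩ʳ a) (pendantFirst ⟨$⟩ʳ b)
SW′-pendantFirst (inj₁ a~b) = SWLink-pendantFirst a~b
SW′-pendantFirst (inj₂ b~a) = Sum.swap (SWLink-pendantFirst b~a)

module Stopwatch (m k : ℕ) (2≤k : 2 ≤ k) (k≤N : k ≤ 4 + m) where

  N : ℕ
  N = 4 + m

  top : Fin N
  top = fromℕ (3 + m)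

  Universal : Fin N → Set
  Universal ℓ = toℕ ℓ < k

  universal-by : ∀ {ℓ ℓ′} → ℓ ≡ ℓ′ → Universal ℓ′ → Universal ℓ
  universal-by ℓ≡ℓ′ = subst Universal (sym ℓ≡ℓ′)

  B-sym : ∀ {i j} → B N k i j → B N k j i
  B-sym (i≢j , uij) = ≢-sym i≢j , Sum.swap uij

  B-transpose-strangers : ∀ {s t} → ¬ Universal s → ¬ Universal t →
    ∀ {i j} → B N k i j → B N k (PC.transpose s t i) (PC.transpose s t j)
  B-transpose-strangers {s} {t} ¬us ¬ut (i≢j , uij) =
    i≢j ∘ ⟨$⟩ʳ-injective (transpose s t) , Sum.map fixes fixes uij
    where
    fixes : ∀ {i} → Universal i → Universal (PC.transpose s t i)
    fixes ui = universal-by (transpose-fixed (λ { refl → ¬us ui }) (λ { refl → ¬ut ui })) ui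

  open FS (SW′ N) (B N k)
  open Sorting Universal

  SW′-irreflexive : ∀ {a b} → SW′ N a b → a ≢ b
  SW′-irreflexive a~b refl = loopless a~b
    where
    chordless : ∀ {a} → a ≡ 1 → suc a ≢ N
    chordless refl ()
    loopless : ∀ {a} → SW′ N a a → ⊥
    loopless (inj₁ (inj₁ a⋖a)) = ℕ.1+n≢n a⋖a
    loopless (inj₂ (inj₁ a⋖a)) = ℕ.1+n≢n a⋖a
    loopless (inj₁ (inj₂ (a≡1 , 1+a≡N))) = chordless a≡1 1+a≡N
    loopless (inj₂ (inj₂ (a≡1 , 1+a≡N))) = chordless a≡1 1+a≡N

  hub-pendant : SW′ N 1F 0F
  hub-pendant = inj₂ (inj₁ refl)

  hub-next : SW′ N 1F 2F
  hub-next = inj₁ (inj₁ refl)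

  hub-top : SW′ N 1F top
  hub-top = inj₁ (inj₂ (refl , cong suc (toℕ-fromℕ (3 + m))))

  below-top : ∀ {z w : Fin N} → z ⋖ w → z ≢ top
  below-top {w = w} z⋖w = <⇒≢ (ℕ.<-≤-trans (ℕ.≤-reflexive z⋖w) (≤fromℕ w))

  slide : ∀ σ {a b} → SW′ N a b → Universal (σ ⟨$⟩ʳ a) ⊎ Universal (σ ⟨$⟩ʳ b) →
          σ ⇝ transpose a b ∘ₚ σ
  slide σ a~b u = swap-⇝ σ a~b (SW′-irreflexive a~b ∘ ⟨$⟩ʳ-injective σ , u)

  exchange-via : ∀ σ {c a b} → SW′ N c a → SW′ N c b → a ≢ b →
    Universal (σ ⟨$⟩ʳ c) → Universal (σ ⟨$⟩ʳ a) ⊎ Universal (σ ⟨$⟩ʳ b) →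
    σ ⇝ transpose a b ∘ₚ σ
  exchange-via σ {c} {a} {b} c~a c~b a≢b uc uab =
    slide σ c~a (inj₁ uc) ◅◅ slide σ₁ c~b u₁ ◅◅ slide σ₂ c~a (inj₂ u₂)
    ◅◅ ≈⇒⇝ (λ x → cong (σ ⟨$⟩ʳ_) (transpose-conjugate c≢a c≢b a≢b x))
    where
    c≢a : c ≢ a
    c≢a = SW′-irreflexive c~a
    c≢b : c ≢ b
    c≢b = SW′-irreflexive c~b
    σ₁ σ₂ : Permutation′ N
    σ₁ = transpose c a ∘ₚ σ
    σ₂ = transpose c b ∘ₚ σ₁
    u₁ : Universal (σ₁ ⟨$⟩ʳ c) ⊎ Universal (σ₁ ⟨$⟩ʳ b)
    u₁ = Sum.map (universal-by (transpose∘ₚ-matchˡ σ c a))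
                 (universal-by (transpose∘ₚ-fixed σ (≢-sym c≢b) (≢-sym a≢b))) uab
    u₂ : Universal (σ₂ ⟨$⟩ʳ a)
    u₂ = universal-by (trans (transpose∘ₚ-fixed σ₁ (≢-sym c≢a) a≢b) (transpose∘ₚ-matchʳ σ c a))
                      uc

  -- The one step that needs a vertex of degree 3; it is what makes two strangers swappable.
  exchange-at-branch : ∀ σ {c p a b} → SW′ N c p → SW′ N c a → SW′ N c b →
    p ≢ a → p ≢ b → a ≢ b → Universal (σ ⟨$⟩ʳ c) → Universal (σ ⟨$⟩ʳ p) →
    σ ⇝ transpose a b ∘ₚ σ
  exchange-at-branch σ {c} {p} {a} {b} c~p c~a c~b p≢a p≢b a≢b uc up =
    exchange-via σ c~a c~p (≢-sym p≢a) uc (inj₂ up)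
    ◅◅ exchange-via σ₁ c~a c~b a≢b (universal-by σ₁c≡σc uc) (inj₁ (universal-by σ₁a≡σp up))
    ◅◅ exchange-via σ₂ c~p c~b p≢b
         (universal-by (trans (transpose∘ₚ-fixed σ₁ c≢a c≢b) σ₁c≡σc) uc)
         (inj₂ (universal-by (trans (transpose∘ₚ-matchʳ σ₁ a b) σ₁a≡σp) up))
    ◅◅ ≈⇒⇝ (λ x → cong (σ ⟨$⟩ʳ_) (transpose-triangle p≢a p≢b a≢b x))
    where
    c≢a : c ≢ a
    c≢a = SW′-irreflexive c~a
    c≢b : c ≢ b
    c≢b = SW′-irreflexive c~b
    σ₁ σ₂ : Permutation′ N
    σ₁ = transpose a p ∘ₚ σ
    σ₂ = transpose a b ∘ₚ σ₁
    σ₁c≡σc : σ₁ ⟨$⟩ʳ c ≡ σ ⟨$⟩ʳ c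
    σ₁c≡σc = transpose∘ₚ-fixed σ c≢a (SW′-irreflexive c~p)
    σ₁a≡σp : σ₁ ⟨$⟩ʳ a ≡ σ ⟨$⟩ʳ p
    σ₁a≡σp = transpose∘ₚ-matchˡ σ a p

  ShiftedUp : ℕ → ℕ → Permutation′ N → Permutation′ N → Set
  ShiftedUp lo hi σ ρ = ∀ z w → z ⋖ w → lo ≤ toℕ z → toℕ w ≤ hi → ρ ⟨$⟩ʳ w ≡ σ ⟨$⟩ʳ z

  WalkedDown : Fin N → Fin N → Permutation′ N → Permutation′ N → Set
  WalkedDown x y σ ρ =
    ρ ⟨$⟩ʳ x ≡ σ ⟨$⟩ʳ y × AgreeBelow (toℕ x) ρ σ × ShiftedUp (toℕ x) (toℕ y) σ ρ

  walk-down : ∀ d σ (x y : Fin N) → toℕ x + d ≡ toℕ y → Universal (σ ⟨$⟩ʳ y) →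
              Reachable σ (WalkedDown x y σ)
  walk-down zero σ x y x+0≡y _ = σ , ε , cong (σ ⟨$⟩ʳ_) x≡y , (λ _ _ → refl) , noRoom
    where
    x≡y : x ≡ y
    x≡y = toℕ-injective (m+0≡n⇒m≡n x+0≡y)
    noRoom : ShiftedUp (toℕ x) (toℕ y) σ σ
    noRoom z w z⋖w x≤z w≤y =
      contradiction (ℕ.≤-trans (subst (_≤ toℕ y) (sym z⋖w) w≤y)
                               (subst (_≤ toℕ z) (cong toℕ x≡y) x≤z))
                    (ℕ.n≮n (toℕ z))
  walk-down (suc d) σ x y x+1+d≡y u with successor (m+1+d≡n⇒m<n x+1+d≡y)
  ... | x′ , x⋖x′
    with walk-down d σ x′ y (subst (λ v → v + d ≡ toℕ y) x⋖x′ (m+1+d≡n⇒1+m+d≡n x+1+d≡y)) u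
  ... | ρ , σ⇝ρ , ρx′≡σy , below , shifted =
    transpose x x′ ∘ₚ ρ , σ⇝ρ ◅◅ slide ρ (inj₁ (inj₁ x⋖x′)) (inj₂ (universal-by ρx′≡σy u)) ,
    trans (transpose∘ₚ-matchˡ ρ x x′) ρx′≡σy , below′ , shifted′
    where
    x<x′ : toℕ x < toℕ x′
    x<x′ = ℕ.≤-reflexive x⋖x′
    below′ : AgreeBelow (toℕ x) (transpose x x′ ∘ₚ ρ) σ
    below′ z z<x = trans (transpose∘ₚ-fixed ρ (<⇒≢ z<x) (<⇒≢ (ℕ.<-trans z<x x<x′)))
                         (below z (ℕ.<-trans z<x x<x′))
    shifted′ : ShiftedUp (toℕ x) (toℕ y) σ (transpose x x′ ∘ₚ ρ)
    shifted′ z w z⋖w x≤z w≤y with toℕ z ℕ.≟ toℕ x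
    ... | yes z≡x =
      atX (toℕ-injective z≡x) (toℕ-injective (trans (sym z⋖w) (trans (cong suc z≡x) x⋖x′)))
      where
      atX : z ≡ x → w ≡ x′ → (transpose x x′ ∘ₚ ρ) ⟨$⟩ʳ w ≡ σ ⟨$⟩ʳ z
      atX refl refl = trans (transpose∘ₚ-matchʳ ρ z w) (below z x<x′)
    ... | no z≢x =
      trans (transpose∘ₚ-fixed ρ (≢-sym (<⇒≢ x<w)) (≢-sym (<⇒≢ x′<w)))
            (shifted z w z⋖w x′≤z w≤y)
      where
      x′≤z : toℕ x′ ≤ toℕ z
      x′≤z = subst (_≤ toℕ z) x⋖x′ (ℕ.≤∧≢⇒< x≤z (≢-sym z≢x))
      x′<w : toℕ x′ < toℕ w
      x′<w = ℕ.≤-<-trans x′≤z (ℕ.≤-reflexive z⋖w)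
      x<w : toℕ x < toℕ w
      x<w = ℕ.<-trans x<x′ x′<w

  Anchored : Permutation′ N → Set
  Anchored σ = Universal (σ ⟨$⟩ʳ 0F) × Universal (σ ⟨$⟩ʳ 1F)

  RotatedFrom : Fin N → Permutation′ N → Permutation′ N → Set
  RotatedFrom lo σ ρ = ρ ⟨$⟩ʳ lo ≡ σ ⟨$⟩ʳ top × ShiftedUp (toℕ lo) (toℕ top) σ ρ

  -- The hub's universal label crosses the chord to the top and walks back down to the hub.
  rotate : ∀ σ → Anchored σ → Reachable σ (λ ρ → Anchored ρ × RotatedFrom 2F σ ρ)
  rotate σ (u0 , u1) =
    ⇝-Reachable (slide σ hub-top (inj₁ u1))
      (Reachable-map rotated (walk-down (2 + m) σ₁ 1F top (sym (toℕ-fromℕ (3 + m))) u₁))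
    where
    σ₁ : Permutation′ N
    σ₁ = transpose 1F top ∘ₚ σ
    u₁ : Universal (σ₁ ⟨$⟩ʳ top)
    u₁ = universal-by (transpose∘ₚ-matchʳ σ 1F top) u1
    rotated : ∀ ρ → WalkedDown 1F top σ₁ ρ → Anchored ρ × RotatedFrom 2F σ ρ
    rotated ρ (ρ1≡σ₁top , below , shifted) =
      (universal-by ρ0≡σ0 u0 , universal-by (trans ρ1≡σ₁top (transpose∘ₚ-matchʳ σ 1F top)) u1) ,
      trans (shifted 1F 2F refl ℕ.≤-refl (s≤s (s≤s z≤n))) (transpose∘ₚ-matchˡ σ 1F top) , shifted′
      where
      ρ0≡σ0 : ρ ⟨$⟩ʳ 0F ≡ σ ⟨$⟩ʳ 0F
      ρ0≡σ0 = trans (below 0F (s≤s z≤n)) (transpose∘ₚ-fixed σ {1F} {top} (λ ()) (λ ()))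
      shifted′ : ShiftedUp 2 (toℕ top) σ ρ
      shifted′ z w z⋖w 2≤z w≤top =
        trans (shifted z w z⋖w (ℕ.<⇒≤ 2≤z) w≤top)
              (transpose∘ₚ-fixed σ (≢-sym (<⇒≢ 2≤z)) (below-top z⋖w))

  rotate-fixing-2 : ∀ {s} σ → Anchored σ × σ ⟨$⟩ʳ 2F ≡ s →
    Reachable σ (λ ρ → (Anchored ρ × ρ ⟨$⟩ʳ 2F ≡ s) × RotatedFrom 3F σ ρ)
  rotate-fixing-2 {s} σ ((u0 , u1) , σ2≡s) =
    ⇝-Reachable (exchange-at-branch σ hub-pendant hub-next hub-top (λ ()) (λ ()) (λ ()) u1 u0)
      (Reachable-map rotated (rotate τ (universal-by τ0≡σ0 u0 , universal-by τ1≡σ1 u1)))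
    where
    τ : Permutation′ N
    τ = transpose 2F top ∘ₚ σ
    τ0≡σ0 : τ ⟨$⟩ʳ 0F ≡ σ ⟨$⟩ʳ 0F
    τ0≡σ0 = transpose∘ₚ-fixed σ {2F} {top} (λ ()) (λ ())
    τ1≡σ1 : τ ⟨$⟩ʳ 1F ≡ σ ⟨$⟩ʳ 1F
    τ1≡σ1 = transpose∘ₚ-fixed σ {2F} {top} (λ ()) (λ ())
    rotated : ∀ ρ → Anchored ρ × RotatedFrom 2F τ ρ →
              (Anchored ρ × ρ ⟨$⟩ʳ 2F ≡ s) × RotatedFrom 3F σ ρ
    rotated ρ (anchored , ρ2≡τtop , shifted) =
      (anchored , trans ρ2≡τtop (trans (transpose∘ₚ-matchʳ σ 2F top) σ2≡s)) ,
      trans (shifted 2F 3F refl ℕ.≤-refl (s≤s (s≤s (s≤s z≤n)))) (transpose∘ₚ-matchˡ σ 2F top) ,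
      shifted′
      where
      shifted′ : ShiftedUp 3 (toℕ top) σ ρ
      shifted′ z w z⋖w 3≤z w≤top =
        trans (shifted z w z⋖w (ℕ.<⇒≤ 3≤z) w≤top)
              (transpose∘ₚ-fixed σ (≢-sym (<⇒≢ 3≤z)) (below-top z⋖w))

  climb : (Inv : Permutation′ N → Set) (lo : Fin N) →
    (∀ σ → Inv σ → Reachable σ (λ ρ → Inv ρ × RotatedFrom lo σ ρ)) →
    ∀ σ p → Inv σ → toℕ lo ≤ toℕ p → Reachable σ (λ ρ → Inv ρ × ρ ⟨$⟩ʳ top ≡ σ ⟨$⟩ʳ p)
  climb Inv lo rotation σ p inv lo≤p =
    go (toℕ top ∸ toℕ p) σ p inv lo≤p (ℕ.m+[n∸m]≡n (≤fromℕ p))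
    where
    go : ∀ d σ p → Inv σ → toℕ lo ≤ toℕ p → toℕ p + d ≡ toℕ top →
         Reachable σ (λ ρ → Inv ρ × ρ ⟨$⟩ʳ top ≡ σ ⟨$⟩ʳ p)
    go zero σ p inv _ p+0≡top =
      σ , ε , inv , cong (σ ⟨$⟩ʳ_) (sym (toℕ-injective (m+0≡n⇒m≡n p+0≡top)))
    go (suc d) σ p inv lo≤p p+1+d≡top with successor (m+1+d≡n⇒m<n p+1+d≡top) | rotation σ inv
    ... | p′ , p⋖p′ | ρ , σ⇝ρ , inv′ , _ , shifted =
      ⇝-Reachable σ⇝ρ
        (Reachable-map
          (λ _ → map₂ (λ τtop≡ρp′ → trans τtop≡ρp′ (shifted p p′ p⋖p′ lo≤p (≤fromℕ p′))))
          (go d ρ p′ inv′ (ℕ.≤-trans lo≤p (ℕ.<⇒≤ (ℕ.≤-reflexive p⋖p′)))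
              (subst (λ v → v + d ≡ toℕ top) p⋖p′ (m+1+d≡n⇒1+m+d≡n p+1+d≡top))))

  held-elsewhere : ∀ (σ : Permutation′ N) {x ℓ} → σ ⟨$⟩ʳ x ≢ ℓ → σ ⟨$⟩ˡ ℓ ≢ x
  held-elsewhere σ σx≢ℓ refl = σx≢ℓ (inverseʳ σ)

  stranger-elsewhere : ∀ (σ : Permutation′ N) {x ℓ} → Universal (σ ⟨$⟩ʳ x) → ¬ Universal ℓ →
                       σ ⟨$⟩ˡ ℓ ≢ x
  stranger-elsewhere σ ux ¬uℓ = held-elsewhere σ (λ σx≡ℓ → ¬uℓ (universal-by (sym σx≡ℓ) ux))

  2≤toℕ : ∀ {x : Fin N} → x ≢ 0F → x ≢ 1F → 2 ≤ toℕ x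
  2≤toℕ {0F} x≢0 _ = contradiction refl x≢0
  2≤toℕ {1F} _ x≢1 = contradiction refl x≢1
  2≤toℕ {suc (suc _)} _ _ = s≤s (s≤s z≤n)

  3≤toℕ : ∀ {x : Fin N} → x ≢ 0F → x ≢ 1F → x ≢ 2F → 3 ≤ toℕ x
  3≤toℕ {0F} x≢0 _ _ = contradiction refl x≢0
  3≤toℕ {1F} _ x≢1 _ = contradiction refl x≢1
  3≤toℕ {2F} _ _ x≢2 = contradiction refl x≢2
  3≤toℕ {suc (suc (suc _))} _ _ _ = s≤s (s≤s (s≤s z≤n))

  ReadyToSwap : Fin N → Fin N → Permutation′ N → Set
  ReadyToSwap s t ρ = Anchored ρ × ρ ⟨$⟩ʳ 2F ≡ s × ρ ⟨$⟩ʳ top ≡ t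

  -- Rotate s up to the top and once more round to 2, then rotate the positions above 2
  -- until t reaches the top.
  place-strangers : ∀ σ {s t} → Anchored σ → ¬ Universal s → ¬ Universal t → s ≢ t →
                    Reachable σ (ReadyToSwap s t)
  place-strangers σ {s} {t} (u0 , u1) ¬us ¬ut s≢t =
    Reachable-bind (climb Anchored 2F rotate σ (σ ⟨$⟩ˡ s) (u0 , u1)
                      (2≤toℕ (stranger-elsewhere σ {0F} u0 ¬us) (stranger-elsewhere σ {1F} u1 ¬us)))
      λ ρ₁ (anchored₁ , ρ₁top≡σs′) →
    Reachable-bind (rotate ρ₁ anchored₁)
      λ ρ₂ ((v0 , v1) , ρ₂2≡ρ₁top , _) →
    let ρ₂2≡s = trans ρ₂2≡ρ₁top (trans ρ₁top≡σs′ (inverseʳ σ)) in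
    Reachable-map (λ { _ ((anchored₃ , ρ₃2≡s) , ρ₃top≡ρ₂t′) →
                         anchored₃ , ρ₃2≡s , trans ρ₃top≡ρ₂t′ (inverseʳ ρ₂) })
      (climb (λ ρ → Anchored ρ × ρ ⟨$⟩ʳ 2F ≡ s) 3F rotate-fixing-2 ρ₂ (ρ₂ ⟨$⟩ˡ t) ((v0 , v1) , ρ₂2≡s)
        (3≤toℕ (stranger-elsewhere ρ₂ {0F} v0 ¬ut) (stranger-elsewhere ρ₂ {1F} v1 ¬ut)
               (held-elsewhere ρ₂ (λ ρ₂2≡t → s≢t (trans (sym ρ₂2≡s) ρ₂2≡t)))))

  Canonical : ℕ → Permutation′ N → Set
  Canonical j σ = AgreeBelow j σ id

  place-label : ∀ ρ j (ℓ : Fin N) → toℕ ℓ ≡ j → j < k → Canonical j ρ →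
                Reachable ρ (Canonical (suc j))
  place-label ρ j ℓ ℓ≡j j<k canonical =
    Reachable-map placed
      (walk-down (toℕ p ∸ j) ρ ℓ p (trans (cong (_+ (toℕ p ∸ j)) ℓ≡j) (ℕ.m+[n∸m]≡n j≤p)) uℓ)
    where
    p : Fin N
    p = ρ ⟨$⟩ˡ ℓ
    j≤p : j ≤ toℕ p
    j≤p = ℕ.≮⇒≥ λ p<j →
      ℕ.<-irrefl (trans (cong toℕ (trans (sym (canonical p p<j)) (inverseʳ ρ))) ℓ≡j) p<j
    uℓ : Universal (ρ ⟨$⟩ʳ p)
    uℓ = universal-by (inverseʳ ρ) (subst (_< k) (sym ℓ≡j) j<k)
    placed : ∀ τ → WalkedDown ℓ p ρ τ → Canonical (suc j) τ
    placed τ (τℓ≡ρp , below , _) =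
      AgreeBelow-extend {σ = τ} {id} ℓ ℓ≡j (trans τℓ≡ρp (inverseʳ ρ))
        (λ z z<j → trans (below z (subst (toℕ z <_) (sym ℓ≡j) z<j)) (canonical z z<j))

  normalise : ∀ σ j → j ≤ k → Reachable σ (Canonical j)
  normalise σ zero _ = σ , ε , λ _ ()
  normalise σ (suc j) j<k =
    Reachable-bind (normalise σ j (ℕ.<⇒≤ j<k))
      λ ρ → place-label ρ j (fromℕ< j<N) (toℕ-fromℕ< j<N) j<k
    where
    j<N : j < N
    j<N = ℕ.<-≤-trans j<k k≤N

  canonical⇒anchored : ∀ {σ} → Canonical 2 σ → Anchored σ
  canonical⇒anchored canonical =
    universal-by (canonical 0F (s≤s z≤n)) (ℕ.<-≤-trans (s≤s z≤n) 2≤k) ,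
    universal-by (canonical 1F (s≤s (s≤s z≤n))) 2≤k

  canonical-agree : ∀ {σ τ} → Canonical k σ → Canonical k τ → AgreeOnUniversal σ τ
  canonical-agree {σ} {τ} canonicalσ canonicalτ x u =
    trans σx≡x (sym (canonicalτ x (subst Universal σx≡x u)))
    where
    σx≡x : σ ⟨$⟩ʳ x ≡ x
    σx≡x = ⟨$⟩ʳ-injective σ (canonicalσ (σ ⟨$⟩ʳ x) u)

  swap-strangers : ∀ σ {s t} → ¬ Universal s → ¬ Universal t → s ≢ t → σ ⇝ σ ∘ₚ transpose s t
  swap-strangers σ {s} {t} ¬us ¬ut s≢t =
    swap-at (Reachable-bind (normalise σ 2 2≤k)
               λ τ canonical → place-strangers τ (canonical⇒anchored {τ} canonical) ¬us ¬ut s≢t)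
    where
    swap-at : Reachable σ (ReadyToSwap s t) → σ ⇝ σ ∘ₚ transpose s t
    swap-at (ρ , σ⇝ρ , (u0 , u1) , ρ2≡s , ρtop≡t) =
      ⇝-∘ₚ-transport B-sym (transpose s t) (B-transpose-strangers ¬us ¬ut) σ⇝ρ
        (exchange-at-branch ρ hub-pendant hub-next hub-top (λ ()) (λ ()) (λ ()) u1 u0
         ◅◅ ≈⇒⇝ (λ x → trans (transpose-natural ρ 2F top x)
                              (cong₂ (λ a b → PC.transpose a b (ρ ⟨$⟩ʳ x)) ρ2≡s ρtop≡t)))

  connected : ∀ σ τ → σ ⇝ τ
  connected σ τ with normalise σ k ℕ.≤-refl | normalise τ k ℕ.≤-refl
  ... | σ′ , σ⇝σ′ , canonicalσ′ | τ′ , τ⇝τ′ , canonicalτ′ =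
    σ⇝σ′
    ◅◅ sort ≈⇒⇝ _◅◅_ swap-strangers σ′ τ′ (canonical-agree {σ′} {τ′} canonicalσ′ canonicalτ′)
    ◅◅ ⇝-sym B-sym τ⇝τ′

mainTheorem3 : (n k : ℕ) → 4 ≤ n → 2 ≤ k → k ≤ n → FSConnected (SW n) (B n k)
mainTheorem3 (suc (suc (suc (suc m)))) k _ 2≤k k≤n =
  FS.⇝⇒FSConnected (SW _) (B _ k)
    (⇝-connected-relabel {G′ = SW′ _} {F = B _ k} pendantFirst SW′-pendantFirst
      (Stopwatch.connected m k 2≤k k≤n))
mainTheorem3 1 k (s≤s ()) _ _
mainTheorem3 2 k (s≤s (s≤s ())) _ _
mainTheorem3 3 k (s≤s (s≤s (s≤s ()))) _ _
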